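{- The stable semantics is sound for intuitionistic propositional logic: if a formula $\varphi$ is provable in intuitionistic propositional logic, then $w\Vdash_{\mathcal{M}}\varphi$ for every stable model $\mathcal{M}=(W,\sqsubseteq,V)$ and every $w\in W$.
   Context: A stable frame is a distributive lattice $(W,\sqsubseteq)$ with bottom $0$ and top $1$. A filter is an upward closed subset of $W$ containing $1$ and closed under binary meets. A stable model is $(W,\sqsubseteq,V)$ with $V$ assigning to each propositional variable a filter. Formulas are built from variables, $\top,\bot,\wedge,\vee,\to$. Forcing: $w\Vdash p$ iff $w\in V(p)$; $w\Vdash\top$ always; $w\Vdash\bot$ iff $w=1$; $w\Vdash\varphi\wedge\psi$ iff $w\Vdash\varphi$ and $w\Vdash\psi$; $w\Vdash\varphi\vee\psi$ iff there exist $v_1,v_2$ with $v_1\wedge v_2\sqsubseteq w$, $v_1\Vdash\varphi$ and $v_2\Vdash\psi$; $w\Vdash\varphi\to\psi$ iff for all $v$ with $w\sqsubseteq v$, $v\Vdash\varphi$ implies $v\Vdash\psi$. -}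

module Defs where

open import Level using (Level; _⊔_) renaming (suc to lsuc)
open import Data.Nat using (ℕ)
open import Data.Product using (Σ; _×_; ∃-syntax)
open import Data.Unit.Polymorphic using (⊤)
open import Relation.Binary.Definitions using (Maximum; Minimum)
open import Relation.Binary.Lattice.Bundles using (DistributiveLattice)

infixr 5 _⇒_
infixr 6 _∨ᶠ_
infixr 7 _∧ᶠ_
data Formula : Set where
  var   : ℕ → Formula
  ⊤ᶠ    : Formula
  ⊥ᶠ    : Formula
  _∧ᶠ_  : Formula → Formula → Formula
  _∨ᶠ_  : Formula → Formula → Formula
  _⇒_   : Formula → Formula → Formula

data ⊢_ : Formula → Set where
  ax-K    : ∀ {φ ψ} → ⊢ (φ ⇒ ψ ⇒ φ)
  ax-S    : ∀ {φ ψ χ} → ⊢ ((φ ⇒ ψ ⇒ χ) ⇒ (φ ⇒ ψ) ⇒ φ ⇒ χ)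
  ax-∧I   : ∀ {φ ψ} → ⊢ (φ ⇒ ψ ⇒ φ ∧ᶠ ψ)
  ax-∧E₁  : ∀ {φ ψ} → ⊢ (φ ∧ᶠ ψ ⇒ φ)
  ax-∧E₂  : ∀ {φ ψ} → ⊢ (φ ∧ᶠ ψ ⇒ ψ)
  ax-∨I₁  : ∀ {φ ψ} → ⊢ (φ ⇒ φ ∨ᶠ ψ)
  ax-∨I₂  : ∀ {φ ψ} → ⊢ (ψ ⇒ φ ∨ᶠ ψ)
  ax-∨E   : ∀ {φ ψ χ} → ⊢ ((φ ⇒ χ) ⇒ (ψ ⇒ χ) ⇒ φ ∨ᶠ ψ ⇒ χ)
  ax-⊥E   : ∀ {φ} → ⊢ (⊥ᶠ ⇒ φ)
  ax-⊤I   : ⊢ ⊤ᶠ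
  mp      : ∀ {φ ψ} → ⊢ (φ ⇒ ψ) → ⊢ φ → ⊢ ψ

record StableFrame (c ℓ₁ ℓ₂ : Level) : Set (lsuc (c ⊔ ℓ₁ ⊔ ℓ₂)) where
  field
    distLattice : DistributiveLattice c ℓ₁ ℓ₂
  open DistributiveLattice distLattice public
  field
    𝟘 : Carrier
    𝟙 : Carrier
    𝟘-minimum : Minimum _≤_ 𝟘
    𝟙-maximum : Maximum _≤_ 𝟙

  record IsFilter (F : Carrier → Set ℓ₂) : Set (c ⊔ ℓ₂) where
    field
      upward : ∀ {u v} → u ≤ v → F u → F v
      has-𝟙  : F 𝟙
      meet   : ∀ {u v} → F u → F v → F (u ∧ v)

record StableModel (c ℓ₁ ℓ₂ : Level) : Set (lsuc (c ⊔ ℓ₁ ⊔ ℓ₂)) where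
  field
    frame : StableFrame c ℓ₁ ℓ₂
  open StableFrame frame public
  field
    V        : ℕ → Carrier → Set ℓ₂
    V-filter : ∀ p → IsFilter (V p)

  infix 4 _⊩_
  _⊩_ : Carrier → Formula → Set (c ⊔ ℓ₁ ⊔ ℓ₂)
  w ⊩ var p   = Level.Lift (c ⊔ ℓ₁) (V p w)
  w ⊩ ⊤ᶠ      = ⊤
  w ⊩ ⊥ᶠ      = Level.Lift (c ⊔ ℓ₂) (w ≈ 𝟙)
  w ⊩ φ ∧ᶠ ψ  = (w ⊩ φ) × (w ⊩ ψ)
  w ⊩ φ ∨ᶠ ψ  = ∃[ v₁ ] ∃[ v₂ ] ((v₁ ∧ v₂ ≤ w) × (v₁ ⊩ φ) × (v₂ ⊩ ψ))
  w ⊩ φ ⇒ ψ   = ∀ v → w ≤ v → v ⊩ φ → v ⊩ ψ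

-- Every truth set ‖φ‖ = {w ∣ w ⊩ φ} is a filter: upward closed, containing 𝟙 and closed
-- under meets. With this, the only non-routine axiom is ∨-elimination: from a witness
-- pair v₁ ∧ v₂ ≤ w one moves to v₁ ∨ w and v₂ ∨ w, which lie above w and force χ, and
-- distributivity gives (v₁ ∨ w) ∧ (v₂ ∨ w) = (v₁ ∧ v₂) ∨ w = w.
module Submission where

open import Defs
open import Level using (Level; lift)
open import Data.Product using (_,_)
import Relation.Binary.Lattice.Properties.MeetSemilattice as MeetSemilatticeProperties
import Relation.Binary.Lattice.Properties.DistributiveLattice as DistributiveLatticeProperties

module Soundness {c ℓ₁ ℓ₂ : Level} (M : StableModel c ℓ₁ ℓ₂) where
  open StableModel M
  open IsFilter
  open MeetSemilatticeProperties meetSemilattice using (∧-monotonic)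
  open DistributiveLatticeProperties distLattice using (∨-distribʳ-∧)

  ∧-interchange-≤ : ∀ a b c d → (a ∧ b) ∧ (c ∧ d) ≤ (a ∧ c) ∧ (b ∧ d)
  ∧-interchange-≤ a b c d =
    ∧-greatest (∧-monotonic (x∧y≤x a b) (x∧y≤x c d)) (∧-monotonic (x∧y≤y a b) (x∧y≤y c d))

  ∨-meet-cover : ∀ {a b v} → a ∧ b ≤ v → (a ∨ v) ∧ (b ∨ v) ≤ v
  ∨-meet-cover {a} {b} {v} a∧b≤v = trans (reflexive (Eq.sym (∨-distribʳ-∧ v a b))) (∨-least a∧b≤v refl)

  ≈𝟙-upward : ∀ {w v} → w ≤ v → w ≈ 𝟙 → v ≈ 𝟙
  ≈𝟙-upward {v = v} w≤v w≈𝟙 = antisym (𝟙-maximum v) (trans (reflexive (Eq.sym w≈𝟙)) w≤v)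

  ⊩-mono : ∀ φ {w v} → w ≤ v → w ⊩ φ → v ⊩ φ
  ⊩-mono (var p)  w≤v (lift w∈V)              = lift (upward (V-filter p) w≤v w∈V)
  ⊩-mono ⊤ᶠ       w≤v _                       = _
  ⊩-mono ⊥ᶠ       w≤v (lift w≈𝟙)              = lift (≈𝟙-upward w≤v w≈𝟙)
  ⊩-mono (φ ∧ᶠ ψ) w≤v (w⊩φ , w⊩ψ)             = ⊩-mono φ w≤v w⊩φ , ⊩-mono ψ w≤v w⊩ψ
  ⊩-mono (φ ∨ᶠ ψ) w≤v (v₁ , v₂ , v₁∧v₂≤w , h) = v₁ , v₂ , trans v₁∧v₂≤w w≤v , h
  ⊩-mono (φ ⇒ ψ)  w≤v w⊩φ⇒ψ u v≤u             = w⊩φ⇒ψ u (trans w≤v v≤u)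

  𝟙⊩ : ∀ φ → 𝟙 ⊩ φ
  𝟙⊩ (var p)  = lift (has-𝟙 (V-filter p))
  𝟙⊩ ⊤ᶠ       = _
  𝟙⊩ ⊥ᶠ       = lift Eq.refl
  𝟙⊩ (φ ∧ᶠ ψ) = 𝟙⊩ φ , 𝟙⊩ ψ
  𝟙⊩ (φ ∨ᶠ ψ) = 𝟙 , 𝟙 , 𝟙-maximum _ , 𝟙⊩ φ , 𝟙⊩ ψ
  𝟙⊩ (φ ⇒ ψ) v 𝟙≤v _ = ⊩-mono ψ 𝟙≤v (𝟙⊩ ψ)

  mutual
    ⊩-∧ : ∀ φ {a b} → a ⊩ φ → b ⊩ φ → a ∧ b ⊩ φ
    ⊩-∧ (var p)  (lift a∈V) (lift b∈V) = lift (meet (V-filter p) a∈V b∈V)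
    ⊩-∧ ⊤ᶠ       _ _                   = _
    ⊩-∧ ⊥ᶠ       (lift a≈𝟙) (lift b≈𝟙) =
      lift (antisym (𝟙-maximum _) (∧-greatest (reflexive (Eq.sym a≈𝟙)) (reflexive (Eq.sym b≈𝟙))))
    ⊩-∧ (φ ∧ᶠ ψ) (a⊩φ , a⊩ψ) (b⊩φ , b⊩ψ) = ⊩-∧ φ a⊩φ b⊩φ , ⊩-∧ ψ a⊩ψ b⊩ψ
    ⊩-∧ (φ ∨ᶠ ψ) (v₁ , v₂ , v₁∧v₂≤a , v₁⊩φ , v₂⊩ψ) (u₁ , u₂ , u₁∧u₂≤b , u₁⊩φ , u₂⊩ψ) =
      v₁ ∧ u₁ , v₂ ∧ u₂ ,
      trans (∧-interchange-≤ v₁ u₁ v₂ u₂) (∧-monotonic v₁∧v₂≤a u₁∧u₂≤b) ,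
      ⊩-∧ φ v₁⊩φ u₁⊩φ , ⊩-∧ ψ v₂⊩ψ u₂⊩ψ
    ⊩-∧ (φ ⇒ ψ) {a} {b} a⊩φ⇒ψ b⊩φ⇒ψ v a∧b≤v v⊩φ =
      ⊩-cover ψ a∧b≤v (a⊩φ⇒ψ (a ∨ v) (x≤x∨y a v) (⊩-mono φ (y≤x∨y a v) v⊩φ))
                      (b⊩φ⇒ψ (b ∨ v) (x≤x∨y b v) (⊩-mono φ (y≤x∨y b v) v⊩φ))

    ⊩-cover : ∀ φ {a b v} → a ∧ b ≤ v → a ∨ v ⊩ φ → b ∨ v ⊩ φ → v ⊩ φ
    ⊩-cover φ a∧b≤v a∨v⊩φ b∨v⊩φ = ⊩-mono φ (∨-meet-cover a∧b≤v) (⊩-∧ φ a∨v⊩φ b∨v⊩φ)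

  ⊩-∨-introˡ : ∀ {φ} ψ {w} → w ⊩ φ → w ⊩ φ ∨ᶠ ψ
  ⊩-∨-introˡ ψ {w} w⊩φ = w , 𝟙 , x∧y≤x w 𝟙 , w⊩φ , 𝟙⊩ ψ

  ⊩-∨-introʳ : ∀ φ {ψ w} → w ⊩ ψ → w ⊩ φ ∨ᶠ ψ
  ⊩-∨-introʳ φ {w = w} w⊩ψ = 𝟙 , w , x∧y≤y 𝟙 w , 𝟙⊩ φ , w⊩ψ

  ⊩-∨-elim : ∀ φ ψ χ {w} → w ⊩ φ ⇒ χ → w ⊩ ψ ⇒ χ → w ⊩ φ ∨ᶠ ψ → w ⊩ χ
  ⊩-∨-elim φ ψ χ {w} w⊩φ⇒χ w⊩ψ⇒χ (v₁ , v₂ , v₁∧v₂≤w , v₁⊩φ , v₂⊩ψ) =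
    ⊩-cover χ v₁∧v₂≤w (w⊩φ⇒χ (v₁ ∨ w) (y≤x∨y v₁ w) (⊩-mono φ (x≤x∨y v₁ w) v₁⊩φ))
                      (w⊩ψ⇒χ (v₂ ∨ w) (y≤x∨y v₂ w) (⊩-mono ψ (x≤x∨y v₂ w) v₂⊩ψ))

  sound : ∀ {φ} → ⊢ φ → ∀ w → w ⊩ φ
  sound (ax-K {φ})          _ v _ v⊩φ u v≤u _ = ⊩-mono φ v≤u v⊩φ
  sound ax-S                _ _ _ f u v≤u g t u≤t t⊩φ = f t (trans v≤u u≤t) t⊩φ t refl (g t u≤t t⊩φ)
  sound (ax-∧I {φ})         _ _ _ v⊩φ u v≤u u⊩ψ = ⊩-mono φ v≤u v⊩φ , u⊩ψ
  sound ax-∧E₁              _ _ _ (v⊩φ , _) = v⊩φ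
  sound ax-∧E₂              _ _ _ (_ , v⊩ψ) = v⊩ψ
  sound (ax-∨I₁ {ψ = ψ})    _ _ _ = ⊩-∨-introˡ ψ
  sound (ax-∨I₂ {φ = φ})    _ _ _ = ⊩-∨-introʳ φ
  sound (ax-∨E {φ} {ψ} {χ}) _ _ _ f u v≤u g t u≤t =
    ⊩-∨-elim φ ψ χ (⊩-mono (φ ⇒ χ) (trans v≤u u≤t) f) (⊩-mono (ψ ⇒ χ) u≤t g)
  sound (ax-⊥E {φ})         _ v _ (lift v≈𝟙) = ⊩-mono φ (reflexive (Eq.sym v≈𝟙)) (𝟙⊩ φ)
  sound ax-⊤I               _ = _
  sound (mp ⊢φ⇒ψ ⊢φ)        w = sound ⊢φ⇒ψ w w refl (sound ⊢φ w)

theorem3p7 : ∀ {c ℓ₁ ℓ₂ : Level} (φ : Formula) → ⊢ φ →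
    (M : StableModel c ℓ₁ ℓ₂) (w : StableModel.Carrier M) → StableModel._⊩_ M w φ
theorem3p7 φ ⊢φ M = Soundness.sound M ⊢φ
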